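{- Let $F$ be a facial walk in a (simple) graph embedded in a surface, such that $F$ has exactly three distinct vertices and these are pairwise adjacent. Then $F=(u,v,w)$ or $F=(u,v,w,u,v,w)$ for some distinct vertices $u,v,w$.
   Context: Graphs are finite and simple (no loops or parallel edges); surfaces are compact 2-manifolds without boundary. -}

module Defs where

open import Data.Nat using (ℕ; zero; suc; _<_)
open import Data.Bool using (Bool; true; false; if_then_else_; _xor_)
open import Data.Fin using (Fin)
open import Data.Fin.Permutation using (Permutation′; _⟨$⟩ʳ_; _⟨$⟩ˡ_)
open import Data.List using (List; map; upTo)
open import Data.Product using (Σ; ∃; _×_; _,_; proj₁)
open import Relation.Binary.PropositionalEquality using (_≡_)
open import Relation.Nullary using (¬_)

iter : ∀ {A : Set} → (A → A) → ℕ → A → A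
iter f zero    x = x
iter f (suc k) x = f (iter f k x)

-- A finite simple graph on vertex set Fin n, together with a combinatorial
-- description of an embedding in a (closed) surface, following
-- Mohar–Thomassen: a rotation system (a cyclic permutation of the
-- neighbours of each vertex) and an edge signature (twisted / untwisted).
record EmbeddedGraph (n : ℕ) : Set₁ where
  field
    Adj      : Fin n → Fin n → Set
    Adj-sym  : ∀ {u v} → Adj u v → Adj v u
    Adj-irr  : ∀ {u} → ¬ Adj u u
    -- rotation at v: a permutation of Fin n that maps the neighbourhood
    -- N(v) onto itself and acts on N(v) as a single cycle
    rot      : Fin n → Permutation′ n
    rot-nbr  : ∀ v u → Adj v u → Adj v (rot v ⟨$⟩ʳ u)
    rot-nbr⁻ : ∀ v u → Adj v (rot v ⟨$⟩ʳ u) → Adj v u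
    rot-cyc  : ∀ v u u′ → Adj v u → Adj v u′ →
               ∃ λ k → iter (rot v ⟨$⟩ʳ_) k u ≡ u′
    -- edge signature: true = the edge uv is twisted (signature -1)
    twisted     : Fin n → Fin n → Bool
    twisted-sym : ∀ u v → twisted u v ≡ twisted v u

  -- State of the face-traversal procedure: we are traversing the arc
  -- (v , u) from v to u, and the current orientation state is s
  -- (false = "+", true = "-").
  State : Set
  State = Fin n × Fin n × Bool

  -- One step of the face-traversal procedure: traverse the edge vu,
  -- update the state by its signature, and leave u along the edge
  -- following vu in the rotation at u (clockwise if state "+",
  -- anticlockwise if state "-").
  step : State → State
  step (v , u , s) =
    let s′ = s xor twisted v u in
    (u , (if s′ then rot u ⟨$⟩ˡ v else rot u ⟨$⟩ʳ v) , s′)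

  vertexOf : State → Fin n
  vertexOf (v , _ , _) = v

  IsFacialWalk : List (Fin n) → Set
  IsFacialWalk W =
    Σ State λ st → Adj (vertexOf st) (proj₁ (Data.Product.proj₂ st)) ×
    Σ ℕ λ k → 0 < k × iter step k st ≡ st ×
      (∀ j → 0 < j → j < k → ¬ iter step j st ≡ st) ×
      W ≡ map (λ i → vertexOf (iter step i st)) (upTo k)

-- Consecutive vertices of a facial walk are adjacent, hence distinct, and the walk never
-- turns back at a vertex of degree at least two, because the rotation there moves every
-- neighbour.  Confined to a triangle, the walk must therefore go round it with period 3.
-- Going round twice traverses every edge twice, so each edge signature is applied an even
-- number of times and the state returns after 6 steps; the first return, which ends the
-- facial walk, happens after 3 or 6 steps, as 1, 2, 4 and 5 would close a shorter cycle.
module Submission where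

open import Defs
open import Data.Nat using (ℕ; zero; suc; _+_; _*_; _<_; z<s; NonZero; >-nonZero)
open import Data.Nat.Properties using (+-comm; m≤m+n)
open import Data.Nat.DivMod using (_%_; _/_; m≡m%n+[m/n]*n; m%n<n)
open import Data.Bool using (Bool; true; false; _xor_; if_then_else_)
open import Data.Bool.Properties using (xor-assoc; xor-comm; not-involutive)
open import Data.Fin using (Fin)
open import Data.Fin.Properties using (_≟_; all?)
open import Data.Fin.Permutation using (_⟨$⟩ʳ_; _⟨$⟩ˡ_; inverseʳ)
open import Data.List using (List; []; _∷_; map; upTo)
open import Data.List.Relation.Unary.Any using (here; there; index)
open import Data.List.Membership.Propositional using (_∈_)
open import Data.List.Membership.Propositional.Properties using (∈-map⁺; ∈-upTo⁺)
open import Data.List.Membership.Setoid.Properties using (index-injective)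
open import Data.Product using (Σ; ∃; _×_; _,_; proj₂)
open import Data.Sum using (_⊎_; inj₁; inj₂)
open import Data.Empty using (⊥-elim)
open import Relation.Nullary using (¬_; yes; no)
open import Relation.Nullary.Decidable using (toWitness; ¬?; _→-dec_)
open import Relation.Binary.PropositionalEquality
  using (_≡_; refl; sym; trans; cong; cong₂; subst; setoid; module ≡-Reasoning)

private
  variable
    A : Set

iter-+ : (f : A → A) (m n : ℕ) (x : A) → iter f (m + n) x ≡ iter f m (iter f n x)
iter-+ f zero    n x = refl
iter-+ f (suc m) n x = cong f (iter-+ f m n x)

iter-fixed : (f : A → A) {x : A} → f x ≡ x → ∀ k → iter f k x ≡ x
iter-fixed f fx zero    = refl
iter-fixed f fx (suc k) = trans (cong f (iter-fixed f fx k)) fx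

iter-*-periodic : (f : A → A) {p : ℕ} {x : A} → iter f p x ≡ x → ∀ q → iter f (q * p) x ≡ x
iter-*-periodic f         fp zero    = refl
iter-*-periodic f {p} {x} fp (suc q) = begin
  iter f (p + q * p) x        ≡⟨ iter-+ f p (q * p) x ⟩
  iter f p (iter f (q * p) x) ≡⟨ cong (iter f p) (iter-*-periodic f fp q) ⟩
  iter f p x                  ≡⟨ fp ⟩
  x                           ∎
  where open ≡-Reasoning

iter-% : (f : A → A) {p : ℕ} .{{_ : NonZero p}} {x : A} →
         iter f p x ≡ x → ∀ m → iter f m x ≡ iter f (m % p) x
iter-% f {p} {x} fp m = begin
  iter f m x                              ≡⟨ cong (λ i → iter f i x) (m≡m%n+[m/n]*n m p) ⟩
  iter f (m % p + (m / p) * p) x          ≡⟨ iter-+ f (m % p) ((m / p) * p) x ⟩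
  iter f (m % p) (iter f ((m / p) * p) x) ≡⟨ cong (iter f (m % p)) (iter-*-periodic f fp (m / p)) ⟩
  iter f (m % p) x                        ∎
  where open ≡-Reasoning

xor-cancelˡ : ∀ x y → x xor (x xor y) ≡ y
xor-cancelˡ false y = refl
xor-cancelˡ true  y = not-involutive y

xor-swapʳ : ∀ x y z → (x xor y) xor z ≡ (x xor z) xor y
xor-swapʳ x y z = begin
  (x xor y) xor z ≡⟨ xor-assoc x y z ⟩
  x xor (y xor z) ≡⟨ cong (x xor_) (xor-comm y z) ⟩
  x xor (z xor y) ≡⟨ xor-assoc x z y ⟨
  (x xor z) xor y ∎
  where open ≡-Reasoning

parity-double-period : (s t : ℕ → Bool) (p : ℕ) → (∀ j → s (suc j) ≡ s j xor t j) →
                       (∀ j → t (j + p) ≡ t j) → s (p + p) ≡ s 0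
parity-double-period s t p s-step t-per = begin
  s (p + p)             ≡⟨ shift p ⟩
  s p xor (s 0 xor s p) ≡⟨ cong (s p xor_) (xor-comm (s 0) (s p)) ⟩
  s p xor (s p xor s 0) ≡⟨ xor-cancelˡ (s p) (s 0) ⟩
  s 0                   ∎
  where
  open ≡-Reasoning
  shift : ∀ j → s (j + p) ≡ s j xor (s 0 xor s p)
  shift zero    = sym (xor-cancelˡ (s 0) (s p))
  shift (suc j) = begin
    s (suc (j + p))                   ≡⟨ s-step (j + p) ⟩
    s (j + p) xor t (j + p)           ≡⟨ cong₂ _xor_ (shift j) (t-per j) ⟩
    (s j xor (s 0 xor s p)) xor t j   ≡⟨ xor-swapʳ (s j) (s 0 xor s p) (t j) ⟩
    (s j xor t j) xor (s 0 xor s p)   ≡⟨ cong (_xor (s 0 xor s p)) (sym (s-step j)) ⟩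
    s (suc j) xor (s 0 xor s p)       ∎

Fin3-third-unique : ∀ (i j k l : Fin 3) →
                    ¬ j ≡ i → ¬ k ≡ i → ¬ k ≡ j → ¬ l ≡ j → ¬ l ≡ k → l ≡ i
Fin3-third-unique = toWitness {a? = all? λ i → all? λ j → all? λ k → all? λ l →
  ¬? (j ≟ i) →-dec ¬? (k ≟ i) →-dec ¬? (k ≟ j) →-dec ¬? (l ≟ j) →-dec ¬? (l ≟ k) →-dec l ≟ i} _

third-unique : {a b c x y z w : A} → let abc = a ∷ b ∷ c ∷ [] in
               x ∈ abc → y ∈ abc → z ∈ abc → w ∈ abc →
               ¬ y ≡ x → ¬ z ≡ x → ¬ z ≡ y → ¬ w ≡ y → ¬ w ≡ z → w ≡ x
third-unique {A = A} x∈ y∈ z∈ w∈ y≢x z≢x z≢y w≢y w≢z =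
  index-injective (setoid A) w∈ x∈
    (Fin3-third-unique (index x∈) (index y∈) (index z∈) (index w∈)
      (distinct y∈ x∈ y≢x) (distinct z∈ x∈ z≢x) (distinct z∈ y∈ z≢y)
      (distinct w∈ y∈ w≢y) (distinct w∈ z∈ w≢z))
  where
  distinct : ∀ {u v xs} (u∈ : u ∈ xs) (v∈ : v ∈ xs) → ¬ u ≡ v → ¬ index u∈ ≡ index v∈
  distinct u∈ v∈ u≢v i≡j = u≢v (index-injective (setoid A) u∈ v∈ i≡j)

≡-triple⇒∈ : {a b c x : A} → x ≡ a ⊎ x ≡ b ⊎ x ≡ c → x ∈ a ∷ b ∷ c ∷ []
≡-triple⇒∈ (inj₁ x≡a)        = here x≡a
≡-triple⇒∈ (inj₂ (inj₁ x≡b)) = there (here x≡b)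
≡-triple⇒∈ (inj₂ (inj₂ x≡c)) = there (there (here x≡c))

module FaceTraversal {n} (G : EmbeddedGraph n) where
  open EmbeddedGraph G

  TwoNeighbours : Fin n → Set
  TwoNeighbours u = Σ (Fin n) λ p → Σ (Fin n) λ q → Adj u p × Adj u q × ¬ p ≡ q

  turn : Fin n → Bool → Fin n → Fin n
  turn u s v = if s then rot u ⟨$⟩ˡ v else rot u ⟨$⟩ʳ v

  turn-adj : ∀ {u v} s → Adj u v → Adj u (turn u s v)
  turn-adj {u} {v} false uv = rot-nbr u v uv
  turn-adj {u} {v} true  uv =
    rot-nbr⁻ u (rot u ⟨$⟩ˡ v) (subst (Adj u) (sym (inverseʳ (rot u))) uv)

  another-neighbour : ∀ {u} → TwoNeighbours u → ∀ v → ∃ λ w → Adj u w × ¬ w ≡ v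
  another-neighbour (p , q , up , uq , p≢q) v with p ≟ v
  ... | yes refl = q , uq , λ q≡p → p≢q (sym q≡p)
  ... | no p≢v   = p , up , p≢v

  -- A fixed neighbour would be an orbit of size one, but the rotation is a single cycle.
  rot-moves : ∀ {u v} → TwoNeighbours u → Adj u v → ¬ rot u ⟨$⟩ʳ v ≡ v
  rot-moves {u} {v} two uv fixed =
    let w , uw , w≢v = another-neighbour two v
        k , orbit    = rot-cyc u v w uv uw
    in  w≢v (trans (sym orbit) (iter-fixed (rot u ⟨$⟩ʳ_) fixed k))

  turn-moves : ∀ {u v} s → TwoNeighbours u → Adj u v → ¬ turn u s v ≡ v
  turn-moves         false two uv = rot-moves two uv
  turn-moves {u} {v} true  two uv fixed =
    rot-moves two uv (trans (cong (rot u ⟨$⟩ʳ_) (sym fixed)) (inverseʳ (rot u)))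

  Arc : State → Set
  Arc (v , u , _) = Adj v u

  step-arc : ∀ st → Arc st → Arc (step st)
  step-arc (v , u , s) vu = turn-adj (s xor twisted v u) (Adj-sym vu)

  module FaceWalk (st : State) where
    vertex : ℕ → Fin n
    vertex j = vertexOf (iter step j st)

    sign : ℕ → Bool
    sign j = proj₂ (proj₂ (iter step j st))

    vertex∈walk : ∀ {k} .{{_ : NonZero k}} → iter step k st ≡ st →
                  ∀ j → vertex j ∈ map vertex (upTo k)
    vertex∈walk {k} returns j =
      subst (_∈ map vertex (upTo k)) (cong vertexOf (sym (iter-% step returns j)))
            (∈-map⁺ vertex (∈-upTo⁺ (m%n<n j k)))

    -- The state after m steps is (vertex m , vertex (suc m) , sign m).
    vertex-period-doubles : ∀ p → (∀ j → vertex (j + p) ≡ vertex j) → iter step (p + p) st ≡ st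
    vertex-period-doubles p period =
      cong₂ _,_ (trans (period p) (period 0))
        (cong₂ _,_ (trans (period (suc p)) (period 1))
          (parity-double-period sign twist p (λ _ → refl)
            (λ j → cong₂ twisted (period j) (period (suc j)))))
      where
      twist : ℕ → Bool
      twist j = twisted (vertex j) (vertex (suc j))

    module _ (arc : Arc st) where
      vertex-adj : ∀ j → Adj (vertex j) (vertex (suc j))
      vertex-adj zero    = arc
      vertex-adj (suc j) = step-arc (iter step j st) (vertex-adj j)

      vertex-suc≢ : ∀ j → ¬ vertex (suc j) ≡ vertex j
      vertex-suc≢ j e = Adj-irr (subst (λ v → Adj v (vertex (suc j))) (sym e) (vertex-adj j))

      no-backtrack : ∀ j → TwoNeighbours (vertex (suc j)) → ¬ vertex (suc (suc j)) ≡ vertex j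
      no-backtrack j two = turn-moves (sign (suc j)) two (Adj-sym (vertex-adj j))

  module TriangleFace (a b c : Fin n) (a≢b : ¬ a ≡ b) (b≢c : ¬ b ≡ c) (a≢c : ¬ a ≡ c)
                      (ab : Adj a b) (bc : Adj b c) (ac : Adj a c)
                      (st : State) (arc : Arc st)
                      (on-triangle : ∀ j → FaceWalk.vertex st j ∈ a ∷ b ∷ c ∷ [])
                      where
    open FaceWalk st

    triangle-two-neighbours : ∀ {x} → x ∈ a ∷ b ∷ c ∷ [] → TwoNeighbours x
    triangle-two-neighbours (here refl)                 = b , c , ab , ac , b≢c
    triangle-two-neighbours (there (here refl))         = a , c , Adj-sym ab , bc , a≢c
    triangle-two-neighbours (there (there (here refl))) = a , b , Adj-sym ac , Adj-sym bc , a≢b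

    two-steps-≢ : ∀ j → ¬ vertex (2 + j) ≡ vertex j
    two-steps-≢ j = no-backtrack arc j (triangle-two-neighbours (on-triangle (suc j)))

    vertex-period-3 : ∀ j → vertex (3 + j) ≡ vertex j
    vertex-period-3 j =
      third-unique (on-triangle j) (on-triangle (1 + j)) (on-triangle (2 + j)) (on-triangle (3 + j))
        (vertex-suc≢ arc j) (two-steps-≢ j) (vertex-suc≢ arc (1 + j)) (two-steps-≢ (1 + j)) (vertex-suc≢ arc (2 + j))

    returns-after-6 : iter step 6 st ≡ st
    returns-after-6 = vertex-period-doubles 3 λ j → trans (cong vertex (+-comm j 3)) (vertex-period-3 j)

    first-return-3-or-6 : ∀ k → 0 < k → iter step k st ≡ st →
                          (∀ j → 0 < j → j < k → ¬ iter step j st ≡ st) → k ≡ 3 ⊎ k ≡ 6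
    first-return-3-or-6 1 _ returns _ = ⊥-elim (vertex-suc≢ arc 0 (cong vertexOf returns))
    first-return-3-or-6 2 _ returns _ = ⊥-elim (two-steps-≢ 0 (cong vertexOf returns))
    first-return-3-or-6 3 _ _       _ = inj₁ refl
    first-return-3-or-6 4 _ returns _ =
      ⊥-elim (vertex-suc≢ arc 0 (trans (sym (vertex-period-3 1)) (cong vertexOf returns)))
    first-return-3-or-6 5 _ returns _ =
      ⊥-elim (two-steps-≢ 0 (trans (sym (vertex-period-3 2)) (cong vertexOf returns)))
    first-return-3-or-6 6 _ _       _ = inj₂ refl
    first-return-3-or-6 (suc (suc (suc (suc (suc (suc (suc k))))))) _ _ first =
      ⊥-elim (first 6 z<s (m≤m+n 7 k) returns-after-6)

    distinct : ¬ vertex 0 ≡ vertex 1 × ¬ vertex 1 ≡ vertex 2 × ¬ vertex 0 ≡ vertex 2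
    distinct = (λ e → vertex-suc≢ arc 0 (sym e)) , (λ e → vertex-suc≢ arc 1 (sym e)) , (λ e → two-steps-≢ 0 (sym e))

    facial-walk-shape : ∀ k → 0 < k → iter step k st ≡ st →
                        (∀ j → 0 < j → j < k → ¬ iter step j st ≡ st) →
                        Σ (Fin n) λ u → Σ (Fin n) λ v → Σ (Fin n) λ w →
                        ¬ u ≡ v × ¬ v ≡ w × ¬ u ≡ w ×
                        (map vertex (upTo k) ≡ u ∷ v ∷ w ∷ [] ⊎
                         map vertex (upTo k) ≡ u ∷ v ∷ w ∷ u ∷ v ∷ w ∷ [])
    facial-walk-shape k 0<k returns first with first-return-3-or-6 k 0<k returns first | distinct
    ... | inj₁ refl | v₀≢v₁ , v₁≢v₂ , v₀≢v₂ =
      vertex 0 , vertex 1 , vertex 2 , v₀≢v₁ , v₁≢v₂ , v₀≢v₂ , inj₁ refl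
    ... | inj₂ refl | v₀≢v₁ , v₁≢v₂ , v₀≢v₂ =
      vertex 0 , vertex 1 , vertex 2 , v₀≢v₁ , v₁≢v₂ , v₀≢v₂ ,
      inj₂ (cong (λ xs → vertex 0 ∷ vertex 1 ∷ vertex 2 ∷ xs)
             (cong₂ _∷_ (vertex-period-3 0)
               (cong₂ _∷_ (vertex-period-3 1) (cong₂ _∷_ (vertex-period-3 2) refl))))

lemma12 : ∀ {n} (G : EmbeddedGraph n) (W : List (Fin n)) →
    EmbeddedGraph.IsFacialWalk G W →
    (Σ (Fin n) λ a → Σ (Fin n) λ b → Σ (Fin n) λ c →
      ¬ a ≡ b × ¬ b ≡ c × ¬ a ≡ c ×
      EmbeddedGraph.Adj G a b × EmbeddedGraph.Adj G b c × EmbeddedGraph.Adj G a c ×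
      a ∈ W × b ∈ W × c ∈ W ×
      (∀ x → x ∈ W → x ≡ a ⊎ x ≡ b ⊎ x ≡ c)) →
    Σ (Fin n) λ u → Σ (Fin n) λ v → Σ (Fin n) λ w →
      ¬ u ≡ v × ¬ v ≡ w × ¬ u ≡ w ×
      (W ≡ u ∷ v ∷ w ∷ [] ⊎ W ≡ u ∷ v ∷ w ∷ u ∷ v ∷ w ∷ [])
lemma12 G ._ (st , arc , k , 0<k , returns , first , refl)
             (a , b , c , a≢b , b≢c , a≢c , ab , bc , ac , _ , _ , _ , only-abc) =
  facial-walk-shape k 0<k returns first
  where
  open FaceTraversal G
  instance
    k≢0 : NonZero k
    k≢0 = >-nonZero 0<k
  open TriangleFace a b c a≢b b≢c a≢c ab bc ac st arc
         (λ j → ≡-triple⇒∈ (only-abc _ (FaceWalk.vertex∈walk st returns j)))
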